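{- Let $G=(V,E)$ be a finite, connected, undirected graph (multiple edges allowed) with at least one edge, let $J\subseteq E$ be a critical set for $G$, let $V_1,\dots,V_k$ be the vertex sets of the $k$ connected components of the graph $(V,E\setminus J)$, and for each $i$ let $E_i$ be the set of edges of $G$ both of whose endpoints lie in $V_i$. Then $\left(\bigcup_{i=1}^k E_i\right)\cap J=\emptyset$.
   Context: $\Gamma$ denotes the set of spanning trees of $G$, each viewed as a set of edges. For $J\subseteq E$, $\mathcal{M}(J)=\min_{\gamma\in\Gamma}|\gamma\cap J|$, and the vulnerability of $J$ is $\theta(J)=\mathcal{M}(J)/|J|$ if $J\neq\emptyset$ and $\theta(\emptyset)=0$. The vulnerability of $G$ is $\theta(G)=\max_{J\subseteq E}\theta(J)$, and $J$ is critical if $\theta(J)=\theta(G)$. -}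

module Defs where

open import Data.Nat using (ℕ; zero; suc; _≤_)
open import Data.Fin using (Fin)
open import Data.Fin.Subset using (Subset; _∈_; _∉_; _∩_; ∁; ∣_∣; ⊤)
open import Data.Product using (_×_; _,_; proj₁; proj₂; Σ; ∃)
open import Data.Integer using (+_)
open import Data.Rational.Unnormalised using (ℚᵘ; mkℚᵘ; 0ℚᵘ)
  renaming (_≤_ to _≤ℚ_)
open import Relation.Binary.PropositionalEquality using (_≡_; _≢_)
open import Relation.Nullary using (¬_)

record Graph : Set where
  field
    n      : ℕ
    m      : ℕ
    ends   : Fin m → Fin n × Fin n
    noLoop : ∀ e → proj₁ (ends e) ≢ proj₂ (ends e)

module _ (G : Graph) where
  open Graph G

  -- u and v are joined by a walk using only edges from S
  -- (i.e. they lie in the same connected component of the spanning subgraph (V , S)).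
  data Reach (S : Subset m) : Fin n → Fin n → Set where
    here : ∀ {u} → Reach S u u
    fwd  : ∀ {u w} (e : Fin m) → e ∈ S → proj₁ (ends e) ≡ u →
           Reach S (proj₂ (ends e)) w → Reach S u w
    bwd  : ∀ {u w} (e : Fin m) → e ∈ S → proj₂ (ends e) ≡ u →
           Reach S (proj₁ (ends e)) w → Reach S u w

  Connected : Set
  Connected = ∀ u v → Reach ⊤ u v

  _without_ : Subset m → Fin m → Subset m
  S without e = S ∩ ∁ (Data.Fin.Subset.⁅ e ⁆)

  SpanningTree : Subset m → Set
  SpanningTree γ =
    (∀ u v → Reach γ u v) ×
    (∀ e → e ∈ γ → ¬ Reach (γ without e) (proj₁ (ends e)) (proj₂ (ends e)))

  IsM : Subset m → ℕ → Set
  IsM J k = (Σ (Subset m) λ γ → SpanningTree γ × ∣ γ ∩ J ∣ ≡ k)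
          × (∀ γ → SpanningTree γ → k ≤ ∣ γ ∩ J ∣)

-- k / d as an unnormalised rational, with the convention k / 0 = 0
ratio : ℕ → ℕ → ℚᵘ
ratio k zero    = 0ℚᵘ
ratio k (suc d) = mkℚᵘ (+ k) d

module _ (G : Graph) where
  open Graph G

  θ-is : Subset m → ℚᵘ → Set
  θ-is J q = ∃ λ k → IsM G J k × q ≡ ratio k ∣ J ∣

  Critical : Subset m → Set
  Critical J = ∃ λ q → θ-is J q × (∀ J' q' → θ-is J' q' → q' ≤ℚ q)

-- Let e ∈ J have its endpoints joined by a walk avoiding J. Every spanning tree γ yields
-- the spanning subgraph (γ ∖ e) ∪ (E ∖ J), which meets J ∖ e inside γ; so 𝓜(J ∖ e) = 𝓜(J).
-- If 𝓜(J) > 0 this gives θ(J ∖ e) = 𝓜(J)/(|J| - 1) > θ(J), contradicting criticality;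
-- if 𝓜(J) = 0 then θ(G) = 0, although θ(E) > 0 since every spanning tree has an edge.
-- The classical choices (a tree attaining 𝓜, a spanning tree inside a connected subgraph)
-- are made under a double negation, which is harmless since the goal is a negation.
module Submission where

open import Defs
open import Data.Nat using (_≤_)
open import Data.Fin.Subset using (Subset; _∈_; ∁)
open import Data.Product using (proj₁; proj₂)
open import Relation.Nullary using (¬_)

open import Data.Nat using (ℕ; zero; suc; _<_; z≤n; s≤s; _≤?_)
open import Data.Nat.Induction using (<-rec)
open import Data.Nat.Properties using (≤-trans; ≤-antisym; ≮⇒≥; <⇒≱; *-cancelˡ-≤)
open import Data.Fin using (Fin; fromℕ<; _≟_)
open import Data.Fin.Subset using (_∩_; _∪_; _⊆_; ⊤; ∣_∣)
open import Data.Fin.Subset.Properties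
open import Data.Product using (Σ; ∃; _×_; _,_)
open import Data.Sum using (inj₁; inj₂)
open import Relation.Nullary using (yes; no)
open import Relation.Nullary.Negation using (¬¬-map; contradiction)
open import Relation.Nullary.Decidable using (decidable-stable)
open import Relation.Binary.PropositionalEquality using (_≡_; _≢_; refl; sym; subst)
open import Data.Integer.Properties using (drop‿+≤+)
open import Data.Rational.Unnormalised using (*≤*) renaming (_≤_ to _≤ℚ_)

Least : (ℕ → Set) → Set
Least P = Σ ℕ λ j → P j × (∀ i → P i → j ≤ i)

¬¬-least : (P : ℕ → Set) → ∀ n → P n → ¬ ¬ Least P
¬¬-least P = <-rec (λ n → P n → ¬ ¬ Least P) step
  where
  step : ∀ n → (∀ {i} → i < n → P i → ¬ ¬ Least P) → P n → ¬ ¬ Least P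
  step n smaller Pn noLeast = noLeast (n , Pn , λ i Pi → ≮⇒≥ λ i<n → smaller i<n Pi noLeast)

ratio-≰-larger-denominator : ∀ {k a b} → 1 ≤ k → 1 ≤ a → a < b → ¬ (ratio k a ≤ℚ ratio k b)
ratio-≰-larger-denominator {suc k} {suc a} {suc b} _ _ a<b (*≤* le) =
  <⇒≱ a<b (*-cancelˡ-≤ (suc k) (drop‿+≤+ le))

ratio-≰-zero : ∀ {k a b} → 1 ≤ k → 1 ≤ a → ¬ (ratio k a ≤ℚ ratio 0 b)
ratio-≰-zero {suc k} {suc a} {zero}  _ _ (*≤* le) with drop‿+≤+ le
... | ()
ratio-≰-zero {suc k} {suc a} {suc b} _ _ (*≤* le) with drop‿+≤+ le
... | ()

module _ {n : ℕ} {p q r : Subset n} where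

  ∩-monoˡ-⊆ : p ⊆ q → p ∩ r ⊆ q ∩ r
  ∩-monoˡ-⊆ p⊆q x∈p∩r with x∈p∩q⁻ p r x∈p∩r
  ... | x∈p , x∈r = x∈p∩q⁺ (p⊆q x∈p , x∈r)

  ∩-monoʳ-⊆ : p ⊆ q → r ∩ p ⊆ r ∩ q
  ∩-monoʳ-⊆ p⊆q x∈r∩p with x∈p∩q⁻ r p x∈r∩p
  ... | x∈r , x∈p = x∈p∩q⁺ (x∈r , p⊆q x∈p)

module _ (G : Graph) where
  open Graph G

  end₁ end₂ : Fin m → Fin n
  end₁ e = proj₁ (ends e)
  end₂ e = proj₂ (ends e)

  Spanning : Subset m → Set
  Spanning S = ∀ u v → Reach G S u v

  infixl 7 _∖_
  _∖_ : Subset m → Fin m → Subset m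
  _∖_ = _without_ G

  ∈-∖⁺ : ∀ {S h g} → h ∈ S → h ≢ g → h ∈ S ∖ g
  ∈-∖⁺ h∈S h≢g = x∈p∩q⁺ (h∈S , x∉p⇒x∈∁p (x≢y⇒x∉⁅y⁆ h≢g))

  ∈-∖⁻ : ∀ {S h g} → h ∈ S ∖ g → h ∈ S × h ≢ g
  ∈-∖⁻ {S} {h} {g} h∈S∖g with x∈p∩q⁻ S _ h∈S∖g
  ... | h∈S , h∉⁅g⁆ = h∈S , λ { refl → x∈∁p⇒x∉p h∉⁅g⁆ (x∈⁅x⁆ g) }

  ∖-⊆ : ∀ {S g} → S ∖ g ⊆ S
  ∖-⊆ {S} h∈S∖g = proj₁ (∈-∖⁻ {S} h∈S∖g)

  ∣∖∣< : ∀ {S g} → g ∈ S → ∣ S ∖ g ∣ < ∣ S ∣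
  ∣∖∣< {S} {g} g∈S = p⊂q⇒∣p∣<∣q∣ {p = S ∖ g} (∖-⊆ , g , g∈S , λ g∈S∖g → proj₂ (∈-∖⁻ {S} g∈S∖g) refl)

  Reach-trans : ∀ {S u v w} → Reach G S u v → Reach G S v w → Reach G S u w
  Reach-trans here          r′ = r′
  Reach-trans (fwd e i p r) r′ = fwd e i p (Reach-trans r r′)
  Reach-trans (bwd e i p r) r′ = bwd e i p (Reach-trans r r′)

  Reach-sym : ∀ {S u v} → Reach G S u v → Reach G S v u
  Reach-sym here             = here
  Reach-sym (fwd e i refl r) = Reach-trans (Reach-sym r) (bwd e i refl here)
  Reach-sym (bwd e i refl r) = Reach-trans (Reach-sym r) (fwd e i refl here)

  Reach-mono : ∀ {S T u v} → S ⊆ T → Reach G S u v → Reach G T u v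
  Reach-mono S⊆T here          = here
  Reach-mono S⊆T (fwd e i p r) = fwd e (S⊆T i) p (Reach-mono S⊆T r)
  Reach-mono S⊆T (bwd e i p r) = bwd e (S⊆T i) p (Reach-mono S⊆T r)

  Reach-detour : ∀ {S T u v} g → (∀ {h} → h ∈ S → h ≢ g → h ∈ T) →
                 Reach G T (end₁ g) (end₂ g) → Reach G S u v → Reach G T u v
  Reach-detour g S∖g⊆T detour here = here
  Reach-detour g S∖g⊆T detour (fwd e i refl r) with e ≟ g
  ... | yes refl = Reach-trans detour (Reach-detour g S∖g⊆T detour r)
  ... | no  e≢g  = fwd e (S∖g⊆T i e≢g) refl (Reach-detour g S∖g⊆T detour r)
  Reach-detour g S∖g⊆T detour (bwd e i refl r) with e ≟ g
  ... | yes refl = Reach-trans (Reach-sym detour) (Reach-detour g S∖g⊆T detour r)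
  ... | no  e≢g  = bwd e (S∖g⊆T i e≢g) refl (Reach-detour g S∖g⊆T detour r)

  Spanning-nonempty : Fin m → ∀ {S} → Spanning S → ∃ (_∈ S)
  Spanning-nonempty e {S} S-spanning = first-edge (S-spanning (end₁ e) (end₂ e)) (noLoop e)
    where
    first-edge : ∀ {u v} → Reach G S u v → u ≢ v → ∃ (_∈ S)
    first-edge here          u≢u = contradiction refl u≢u
    first-edge (fwd h i _ _) _   = h , i
    first-edge (bwd h i _ _) _   = h , i

  Spanning-∖ : ∀ {S g} → Reach G (S ∖ g) (end₁ g) (end₂ g) → Spanning S → Spanning (S ∖ g)
  Spanning-∖ {S} {g} detour S-spanning u v = Reach-detour g (∈-∖⁺ {S}) detour (S-spanning u v)

  ¬¬-SpanningTree-⊆ : ∀ {S} → Spanning S → ¬ ¬ (Σ (Subset m) λ T → SpanningTree G T × T ⊆ S)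
  ¬¬-SpanningTree-⊆ {S} S-spanning = ¬¬-map tree (¬¬-least Size ∣ S ∣ (S , ⊆-refl , S-spanning , refl))
    where
    Size : ℕ → Set
    Size i = Σ (Subset m) λ T → T ⊆ S × Spanning T × ∣ T ∣ ≡ i

    -- A spanning subgraph of least size is acyclic: deleting an edge on a cycle keeps it spanning.
    tree : Least Size → Σ (Subset m) λ T → SpanningTree G T × T ⊆ S
    tree (_ , (T , T⊆S , T-spanning , refl) , least) = T , (T-spanning , acyclic) , T⊆S
      where
      acyclic : ∀ e → e ∈ T → ¬ Reach G (T ∖ e) (end₁ e) (end₂ e)
      acyclic e e∈T cycle = <⇒≱ (∣∖∣< e∈T)
        (least _ (T ∖ e , ⊆-trans (∖-⊆ {T}) T⊆S , Spanning-∖ cycle T-spanning , refl))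

  IsM-≤-Spanning : ∀ {J k S} → IsM G J k → Spanning S → k ≤ ∣ S ∩ J ∣
  IsM-≤-Spanning {J} {k} {S} (_ , minimal) S-spanning = decidable-stable (k ≤? ∣ S ∩ J ∣)
    (¬¬-map (λ { (T , T-tree , T⊆S) → ≤-trans (minimal T T-tree) (p⊆q⇒∣p∣≤∣q∣ (∩-monoˡ-⊆ T⊆S)) })
            (¬¬-SpanningTree-⊆ S-spanning))

  IsM-∖ : ∀ {J k e} → IsM G J k → Reach G (∁ J) (end₁ e) (end₂ e) → IsM G (J ∖ e) k
  IsM-∖ {J} {k} {e} M@((γ , γ-tree , refl) , _) detour =
    (γ , γ-tree , ≤-antisym (p⊆q⇒∣p∣≤∣q∣ (∩-monoʳ-⊆ {r = γ} (∖-⊆ {J} {e}))) (bound γ γ-tree)) , bound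
    where
    bound : ∀ γ′ → SpanningTree G γ′ → k ≤ ∣ γ′ ∩ (J ∖ e) ∣
    bound γ′ (γ′-spanning , _) = ≤-trans (IsM-≤-Spanning M S-spanning) (p⊆q⇒∣p∣≤∣q∣ S∩J⊆γ′∩J∖e)
      where
      S : Subset m
      S = γ′ ∖ e ∪ ∁ J

      S-spanning : Spanning S
      S-spanning u v = Reach-detour e (λ h∈γ′ h≢e → x∈p∪q⁺ (inj₁ (∈-∖⁺ h∈γ′ h≢e)))
        (Reach-mono (q⊆p∪q (γ′ ∖ e) (∁ J)) detour) (γ′-spanning u v)

      S∩J⊆γ′∩J∖e : S ∩ J ⊆ γ′ ∩ (J ∖ e)
      S∩J⊆γ′∩J∖e x∈S∩J with x∈p∩q⁻ S J x∈S∩J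
      ... | x∈S , x∈J with x∈p∪q⁻ (γ′ ∖ e) (∁ J) x∈S
      ... | inj₂ x∈∁J   = contradiction x∈J (x∈∁p⇒x∉p x∈∁J)
      ... | inj₁ x∈γ′∖e with ∈-∖⁻ {γ′} x∈γ′∖e
      ... | x∈γ′ , x≢e  = x∈p∩q⁺ (x∈γ′ , ∈-∖⁺ x∈J x≢e)

  IsM-≤-∣∣ : ∀ {J k} → IsM G J k → k ≤ ∣ J ∣
  IsM-≤-∣∣ {J} ((γ , _ , refl) , _) = ∣p∩q∣≤∣q∣ γ J

  ¬¬-IsM : ∀ {γ} J → SpanningTree G γ → ¬ ¬ (∃ (IsM G J))
  ¬¬-IsM {γ} J γ-tree = ¬¬-map isM (¬¬-least Attained _ (γ , γ-tree , refl))
    where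
    Attained : ℕ → Set
    Attained i = Σ (Subset m) λ γ′ → SpanningTree G γ′ × ∣ γ′ ∩ J ∣ ≡ i

    isM : Least Attained → ∃ (IsM G J)
    isM (k , attained , least) = k , attained , λ γ′ γ′-tree → least _ (γ′ , γ′-tree , refl)

  IsM-⊤-positive : Fin m → ∀ {k} → IsM G ⊤ k → 1 ≤ k
  IsM-⊤-positive e ((γ , (γ-spanning , _) , refl) , _) with Spanning-nonempty e γ-spanning
  ... | h , h∈γ = ≤-trans (s≤s z≤n) (∣∖∣< {g = h} (x∈p∩q⁺ (h∈γ , ∈⊤)))

lemma7 : (G : Graph) → Connected G → 1 ≤ Graph.m G →
         (J : Subset (Graph.m G)) → Critical G J →
         ∀ e → e ∈ J →
         ¬ Reach G (∁ J) (proj₁ (Graph.ends G e)) (proj₂ (Graph.ends G e))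
lemma7 G _ m≥1 J (_ , (zero , ((γ , γ-tree , _) , _) , refl) , maximal) _ _ _ =
  ¬¬-IsM G ⊤ γ-tree λ (k , M⊤) →
    ratio-≰-zero {b = ∣ J ∣} (IsM-⊤-positive G (fromℕ< m≥1) M⊤) (subst (1 ≤_) (sym (∣⊤∣≡n _)) m≥1)
      (maximal ⊤ _ (k , M⊤ , refl))
lemma7 G _ _ J (_ , (suc k , M , refl) , maximal) e e∈J detour =
  ratio-≰-larger-denominator (s≤s z≤n) (≤-trans (s≤s z≤n) (IsM-≤-∣∣ G M∖e)) (∣∖∣< G {J} e∈J)
    (maximal (_without_ G J e) _ (suc k , M∖e , refl))
  where
  M∖e : IsM G (_without_ G J e) (suc k)
  M∖e = IsM-∖ G M detour
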